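{- Let $k\ge 2$, $n\ge 1$, and let $c\in\{2,3,\dots,k^n-1\}$. Put $m=\lfloor \log_k c\rfloor$, $y=\lfloor c/k^m\rfloor$, $j=\lfloor \log_k(k^n+1-c)\rfloor$ and $x=k+1-\lfloor (k^n+1-c)/k^j\rfloor$. Number the vertices of layer $n+1$ from $1$ to $k^n$ from left to right. Then the leftmost vertex of layer $n+1$ at which chip $c$ can land has index $xk^{n-1-j}$, the rightmost such vertex has index $1+(y-1)k^{n-m-1}+(k-1)\sum_{i=n-m}^{n-1}k^i=1+(y-1)k^{n-m-1}+k^n-k^{n-m}$, and hence the spread of $c$ equals \[2+(y-1)k^{n-m-1}+k^n-k^{n-m}-xk^{n-1-j}.\]
   Context: The infinite rooted directed $k$-ary tree: every vertex has $k$ children ordered from leftmost to rightmost; the root is on layer 1 and children of a vertex on layer $\ell$ are on layer $\ell+1$. Labeled chip-firing: initially chips labeled $1,\dots,k^n$ are on the root; a vertex holding at least $k$ chips may fire by choosing any $k$ of its chips and sending the chip with the $r$-th smallest label to its $r$-th leftmost child ($r=1,\dots,k$); the game ends when no vertex can fire (stable configuration), in which each vertex of layer $n+1$ holds exactly one chip. A chip can land at a vertex of layer $n+1$ if some firing strategy yields a stable configuration with that chip on that vertex. The spread of a chip is (index of the rightmost vertex of layer $n+1$ at which it can land) $-$ (index of the leftmost such vertex) $+1$. -}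

module Defs where

open import Data.Nat using (ℕ; zero; suc; _+_; _*_; _∸_; _^_; _≤_; _<_)
open import Data.Fin as Fin using (Fin; toℕ)
open import Data.List using (List; []; _∷_; _++_; [_]; length)
open import Data.Product using (Σ; ∃; _×_; _,_)
open import Data.Sum using (_⊎_)
open import Relation.Binary.PropositionalEquality using (_≡_; _≢_)
open import Relation.Binary.Construct.Closure.ReflexiveTransitive using (Star)
open import Relation.Nullary using (¬_)

-- A vertex of the infinite rooted k-ary tree is the path from the root:
-- a list of child indices (0 = leftmost child, k-1 = rightmost child).
-- The root is [] (layer 1); a vertex given by a list of length ℓ-1 is on layer ℓ.
Vertex : ℕ → Set
Vertex k = List (Fin k)

child : ∀ {k} → Vertex k → Fin k → Vertex k
child v r = v ++ [ r ]

-- Chips are Fin (k ^ n); chip a has label suc (toℕ a) ∈ {1, …, k^n},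
-- so the order of labels is the order of Fin.
-- A configuration assigns to each chip the vertex holding it.
Config : ℕ → ℕ → Set
Config k n = Fin (k ^ n) → Vertex k

initial : ∀ k n → Config k n
initial k n _ = []

-- One firing: vertex v fires the k chips f 0 < f 1 < … < f (k-1) (by label),
-- all located at v; chip f r (the r-th smallest, 0-based) moves to child v r.
Fire : ∀ k n → Config k n → Config k n → Set
Fire k n σ σ' =
  Σ (Vertex k) λ v → Σ (Fin k → Fin (k ^ n)) λ f →
    (∀ r s → r Fin.< s → f r Fin.< f s) ×
    (∀ r → σ (f r) ≡ v) ×
    (∀ a → (Σ (Fin k) λ r → f r ≡ a × σ' a ≡ child v r)
         ⊎ ((∀ r → f r ≢ a) × σ' a ≡ σ a))

-- σ is stable: no vertex holds at least k chips.
Stable : ∀ k n → Config k n → Set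
Stable k n σ =
  ∀ (v : Vertex k) (f : Fin k → Fin (k ^ n)) →
    (∀ r s → f r ≡ f s → r ≡ s) → ¬ (∀ r → σ (f r) ≡ v)

-- Index (1-based, left to right) of a vertex within its layer:
-- 1 + the base-k number whose digits are the path, most significant first.
pathValue : ∀ {k} → ℕ → Vertex k → ℕ
pathValue acc [] = acc
pathValue {k} acc (d ∷ ds) = pathValue (acc * k + toℕ d) ds

index : ∀ {k} → Vertex k → ℕ
index v = suc (pathValue 0 v)

CanLand : ∀ k n → Fin (k ^ n) → ℕ → Set
CanLand k n a i =
  Σ (Config k n) λ σ → Star (Fire k n) (initial k n) σ × Stable k n σ ×
    length (σ a) ≡ n × index (σ a) ≡ i

IsLeftmost : ∀ k n → Fin (k ^ n) → ℕ → Set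
IsLeftmost k n a L = CanLand k n a L × (∀ i → CanLand k n a i → L ≤ i)

IsRightmost : ∀ k n → Fin (k ^ n) → ℕ → Set
IsRightmost k n a R = CanLand k n a R × (∀ i → CanLand k n a i → i ≤ R)

HasSpread : ∀ k n → Fin (k ^ n) → ℕ → Set
HasSpread k n a s =
  Σ ℕ λ L → Σ ℕ λ R → IsLeftmost k n a L × IsRightmost k n a R × s ≡ R + 1 ∸ L

IsFloorLog : ℕ → ℕ → ℕ → Set
IsFloorLog k c m = k ^ m ≤ c × c < k ^ suc m

IsFloorDiv : ℕ → ℕ → ℕ → Set
IsFloorDiv c d q = q * d ≤ c × c < suc q * d

module Submission where

-- A firing sends the r-th smallest of its chips to the r-th child, so in every
-- reachable configuration the subtree of a vertex u·s holds at least as many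
-- chips of label ≤ c as the subtree of any right sibling u·r.  The subtree of
-- u·r therefore holds at most a fraction 1/(r+1) of those below u, and along
-- the path d₁ … dₙ of chip c this gives ∏ (dᵢ + 1) ≤ c.  The rightmost path
-- with ∏ (dᵢ + 1) < (y + 1) kᵐ is (k-1)ᵐ (y-1) 0 … 0, and it is attained: at
-- each vertex, fire chip c last in firing ⌊c/k⌋ - 1, to the rightmost child (a
-- rotation of the standard firing order), after which it is the chip of label
-- ⌊c/k⌋ among those at that child.  Reflecting the tree and reversing the
-- labels maps firing sequences to firing sequences, chip c to chip kⁿ + 1 - c
-- and vertex i of the last layer to vertex kⁿ + 1 - i, so the leftmost vertex
-- of c mirrors the rightmost vertex of kⁿ + 1 - c.

open import Defs
open import Data.Nat using (ℕ; zero; suc; pred; NonZero; >-nonZero; >-nonZero⁻¹;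
  _+_; _*_; _∸_; _^_; _≤_; _<_; z≤n; s≤s; s≤s⁻¹)
open import Data.Nat.Properties
open import Data.Nat.DivMod
open import Data.Bool using (if_then_else_; _∧_)
open import Data.Fin as Fin using (Fin; toℕ; zero; suc)
import Data.Fin.Properties as Fin
open import Data.List using (List; []; _∷_; _++_; [_]; length; map)
import Data.List.Properties as List
open import Data.List.Relation.Binary.Prefix.Heterogeneous using (Prefix; []; _∷_; _++ᵖ_)
open import Data.List.Relation.Binary.Prefix.Heterogeneous.Properties using (fromPointwise; prefix?)
import Data.List.Relation.Binary.Prefix.Heterogeneous.Properties as Prefix
import Data.List.Relation.Binary.Pointwise as Pointwise
open import Data.Product using (Σ; ∃; _×_; _,_; proj₁; proj₂)
open import Data.Sum using (_⊎_; inj₁; inj₂)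
open import Data.Empty using (⊥-elim)
open import Function using (_∘_)
open import Relation.Nullary using (¬_; Dec; yes; no; does; _×-dec_)
open import Relation.Nullary.Decidable using (dec-true; dec-false)
open import Relation.Unary using (Pred; Decidable)
open import Relation.Binary using (tri<; tri≈; tri>)
open import Relation.Binary.PropositionalEquality hiding ([_])
open import Relation.Binary.Construct.Closure.ReflexiveTransitive using (Star; ε; _◅_; _◅◅_)
import Relation.Binary.Construct.Closure.ReflexiveTransitive as Star
open import Algebra.Properties.CommutativeSemigroup +-commutativeSemigroup
  using (x∙yz≈y∙xz) renaming (interchange to +-interchange)
open import Algebra.Properties.Semiring.Sum +-*-semiring
  using (sum; ∑-comm; ∑-distrib-+; sum-cong-≗)

𝟙 : ∀ {p} {P : Set p} → Dec P → ℕ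
𝟙 (yes _) = 1
𝟙 (no _)  = 0

𝟙-mono : ∀ {p q} {P : Set p} {Q : Set q} → (P → Q) → (P? : Dec P) (Q? : Dec Q) → 𝟙 P? ≤ 𝟙 Q?
𝟙-mono P→Q (yes _) (yes _) = ≤-refl
𝟙-mono P→Q (yes p) (no ¬q) = ⊥-elim (¬q (P→Q p))
𝟙-mono P→Q (no _)  _       = z≤n

𝟙-cong : ∀ {p q} {P : Set p} {Q : Set q} → (P → Q) → (Q → P) → (P? : Dec P) (Q? : Dec Q) → 𝟙 P? ≡ 𝟙 Q?
𝟙-cong P→Q Q→P P? Q? = ≤-antisym (𝟙-mono P→Q P? Q?) (𝟙-mono Q→P Q? P?)

𝟙-yes : ∀ {p} {P : Set p} → P → (P? : Dec P) → 𝟙 P? ≡ 1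
𝟙-yes p (yes _) = refl
𝟙-yes p (no ¬p) = ⊥-elim (¬p p)

𝟙-no : ∀ {p} {P : Set p} → ¬ P → (P? : Dec P) → 𝟙 P? ≡ 0
𝟙-no ¬p (yes p) = ⊥-elim (¬p p)
𝟙-no ¬p (no _)  = refl

∑-mono-≤ : ∀ {N} {f g : Fin N → ℕ} → (∀ i → f i ≤ g i) → sum f ≤ sum g
∑-mono-≤ {zero}  f≤g = z≤n
∑-mono-≤ {suc N} f≤g = +-mono-≤ (f≤g zero) (∑-mono-≤ (λ i → f≤g (suc i)))

∑-zero : ∀ {N} {f : Fin N → ℕ} → (∀ i → f i ≡ 0) → sum f ≡ 0
∑-zero {zero}  f≡0 = refl
∑-zero {suc N} f≡0 = cong₂ _+_ (f≡0 zero) (∑-zero (λ i → f≡0 (suc i)))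

term-≤-∑ : ∀ {N} (f : Fin N → ℕ) i → f i ≤ sum f
term-≤-∑ f zero    = m≤m+n _ _
term-≤-∑ f (suc i) = ≤-trans (term-≤-∑ (λ j → f (suc j)) i) (m≤n+m _ _)

*-≤-∑ : ∀ {N x} (f : Fin N → ℕ) (r : Fin N) → (∀ s → s Fin.≤ r → x ≤ f s) → suc (toℕ r) * x ≤ sum f
*-≤-∑ f zero    x≤f = +-mono-≤ (x≤f zero z≤n) z≤n
*-≤-∑ f (suc r) x≤f =
  +-mono-≤ (x≤f zero z≤n) (*-≤-∑ (λ j → f (suc j)) r (λ s s≤r → x≤f (suc s) (s≤s s≤r)))

∑-𝟙-unique : ∀ {N p} {P : Pred (Fin N) p} (P? : Decidable P) →
             (∀ i j → P i → P j → i ≡ j) → sum (λ i → 𝟙 (P? i)) ≤ 1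
∑-𝟙-unique {zero}  P? unique = z≤n
∑-𝟙-unique {suc N} P? unique with P? zero
... | yes p = ≤-reflexive (cong suc (∑-zero (λ i → 𝟙-no (λ q → Fin.0≢1+n (unique zero (suc i) p q)) (P? (suc i)))))
... | no _  = ∑-𝟙-unique (λ i → P? (suc i)) (λ i j p q → Fin.suc-injective (unique (suc i) (suc j) p q))

∑-𝟙-≟ : ∀ {N p} {P : Pred (Fin N) p} (P? : Decidable P) x →
        sum (λ b → 𝟙 (P? b ×-dec x Fin.≟ b)) ≡ 𝟙 (P? x)
∑-𝟙-≟ {suc N} P? zero = trans (cong₂ _+_
  (𝟙-cong proj₁ (_, refl) (P? zero ×-dec zero Fin.≟ zero) (P? zero))
  (∑-zero (λ b → 𝟙-no (λ { (_ , ()) }) (P? (suc b) ×-dec zero Fin.≟ suc b)))) (+-identityʳ _)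
∑-𝟙-≟ {suc N} P? (suc x) = begin
  𝟙 (P? zero ×-dec suc x Fin.≟ zero) + sum (λ b → 𝟙 (P? (suc b) ×-dec suc x Fin.≟ suc b))
    ≡⟨ cong₂ _+_ (𝟙-no (λ { (_ , ()) }) (P? zero ×-dec suc x Fin.≟ zero))
                 (sum-cong-≗ (λ b → 𝟙-cong (λ (p , e) → p , Fin.suc-injective e) (λ (p , e) → p , cong suc e)
                                           (P? (suc b) ×-dec suc x Fin.≟ suc b) (P? (suc b) ×-dec x Fin.≟ b))) ⟩
  sum (λ b → 𝟙 (P? (suc b) ×-dec x Fin.≟ b))
    ≡⟨ ∑-𝟙-≟ (λ b → P? (suc b)) x ⟩
  𝟙 (P? (suc x)) ∎
  where open ≡-Reasoning

∑-𝟙-≤-bound : ∀ N x → sum {N} (λ b → 𝟙 (toℕ b ≤? x)) ≤ suc x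
∑-𝟙-≤-bound zero    x       = z≤n
∑-𝟙-≤-bound (suc N) zero    = ≤-reflexive (cong suc (∑-zero {N} (λ b → 𝟙-no (λ ()) (suc (toℕ b) ≤? zero))))
∑-𝟙-≤-bound (suc N) (suc x) = s≤s (≤-trans
  (≤-reflexive (sum-cong-≗ {N} (λ b → 𝟙-cong s≤s⁻¹ s≤s (suc (toℕ b) ≤? suc x) (toℕ b ≤? x))))
  (∑-𝟙-≤-bound N x))

pred[n]<n : ∀ n .{{_ : NonZero n}} → pred n < n
pred[n]<n n = subst (pred n <_) (suc-pred n) (n<1+n (pred n))

increasing⇒injective : ∀ {m N} {f : Fin m → Fin N} → (∀ r s → r Fin.< s → f r Fin.< f s) →
                       ∀ {r s} → f r ≡ f s → r ≡ s
increasing⇒injective inc {r} {s} e with Fin.<-cmp r s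
... | tri< r<s _ _ = ⊥-elim (<⇒≢ (inc r s r<s) (cong toℕ e))
... | tri≈ _ r≡s _ = r≡s
... | tri> _ _ s<r = ⊥-elim (<⇒≢ (inc s r s<r) (cong toℕ (sym e)))

increasing⇒monotone : ∀ {m N} {f : Fin m → Fin N} → (∀ r s → r Fin.< s → f r Fin.< f s) →
                      ∀ {r s} → r Fin.≤ s → f r Fin.≤ f s
increasing⇒monotone inc {r} {s} r≤s with Fin.<-cmp r s
... | tri< r<s _ _  = <⇒≤ (inc r s r<s)
... | tri≈ _ refl _ = ≤-refl
... | tri> _ _ s<r  = ⊥-elim (<⇒≱ s<r r≤s)

IncreasingOn : ∀ {N} → ℕ → (ℕ → Fin N) → Set
IncreasingOn M e = ∀ {i j} → i < j → j < M → e i Fin.< e j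

increasingOn⇒injective : ∀ {N M} {e : ℕ → Fin N} → IncreasingOn M e →
                         ∀ {i j} → i < M → j < M → e i ≡ e j → i ≡ j
increasingOn⇒injective inc {i} {j} i<M j<M e≡ with <-cmp i j
... | tri< i<j _ _ = ⊥-elim (<⇒≢ (inc i<j j<M) (cong toℕ e≡))
... | tri≈ _ i≡j _ = i≡j
... | tri> _ _ j<i = ⊥-elim (<⇒≢ (inc j<i i<M) (cong toℕ (sym e≡)))

opposite-< : ∀ {k} {r s : Fin k} → r Fin.< s → Fin.opposite s Fin.< Fin.opposite r
opposite-< {r = r} {s} r<s = subst₂ _<_ (sym (Fin.opposite-prop s)) (sym (Fin.opposite-prop r))
                                      (∸-monoʳ-< (s≤s r<s) (Fin.toℕ<n s))

label-opposite : ∀ {N} (a : Fin N) → suc (toℕ (Fin.opposite a)) ≡ N + 1 ∸ suc (toℕ a)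
label-opposite {N} a = trans (cong suc (Fin.opposite-prop a)) (sym (trans (+-∸-comm 1 (Fin.toℕ<n a)) (+-comm _ 1)))

floorLog-< : ∀ {k c m n} .{{_ : NonZero k}} → IsFloorLog k c m → c < k ^ n → m < n
floorLog-< {k} {c} {m} {n} (k^m≤c , _) c<k^n with m <? n
... | yes m<n = m<n
... | no m≮n  = ⊥-elim (<⇒≱ c<k^n (≤-trans (^-monoʳ-≤ k (≮⇒≥ m≮n)) k^m≤c))

floorDiv-pos : ∀ {c d y} → d ≤ c → IsFloorDiv c d y → 1 ≤ y
floorDiv-pos {c} {d} {zero}  d≤c (_ , c<d) = ⊥-elim (<⇒≱ (subst (c <_) (+-identityʳ d) c<d) d≤c)
floorDiv-pos {y = suc _} _ _ = s≤s z≤n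

module _ {k : ℕ} .{{_ : NonZero k}} where

  pred[k]<k^[1+t] : ∀ t → pred k < k ^ suc t
  pred[k]<k^[1+t] t = <-≤-trans (pred[n]<n k) (m≤m*n k (k ^ t) {{m^n≢0 k t}})

  *-≤⇒≤-/ : ∀ {x c} → x * k ≤ c → x ≤ c / k
  *-≤⇒≤-/ {x} x*k≤c = subst (_≤ _) (m*n/n≡m x k) (/-monoˡ-≤ k x*k≤c)

  c<[1+c/k]*k : ∀ c → c < suc (c / k) * k
  c<[1+c/k]*k c = begin-strict
    c                    ≡⟨ m≡m%n+[m/n]*n c k ⟩
    c % k + c / k * k    <⟨ +-monoˡ-< (c / k * k) (m%n<n c k) ⟩
    k + c / k * k        ∎
    where open ≤-Reasoning

  floorLog-/ : ∀ {c m} → IsFloorLog k c (suc m) → IsFloorLog k (c / k) m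
  floorLog-/ {c} {m} (lower , upper) =
    *-≤⇒≤-/ (subst (_≤ c) (*-comm k (k ^ m)) lower) ,
    m<n*o⇒m/o<n (subst (c <_) (*-comm k (k ^ suc m)) upper)

  floorDiv-/ : ∀ {c m y} → IsFloorDiv c (k ^ suc m) y → IsFloorDiv (c / k) (k ^ m) y
  floorDiv-/ {c} {m} {y} (lower , upper) =
    *-≤⇒≤-/ (subst (_≤ c) (shift y) lower) , m<n*o⇒m/o<n (subst (c <_) (shift (suc y)) upper)
    where
    shift : ∀ x → x * (k * k ^ m) ≡ x * k ^ m * k
    shift x = trans (cong (x *_) (*-comm k (k ^ m))) (sym (*-assoc x (k ^ m) k))

  grid-% : ∀ g {r} → r < k → (g * k + r) % k ≡ r
  grid-% g {r} r<k = trans (%-congˡ (+-comm (g * k) r)) (trans ([m+kn]%n≡m%n r g k) (m<n⇒m%n≡m r<k))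

  grid-/ : ∀ g {r} → r < k → (g * k + r) / k ≡ g
  grid-/ g {r} r<k = begin
    (g * k + r) / k       ≡⟨ +-distrib-/ (g * k) r (subst (_< k) (sym (cong₂ _+_ (m*n%n≡0 g k) (m<n⇒m%n≡m r<k))) r<k) ⟩
    g * k / k + r / k     ≡⟨ cong₂ _+_ (m*n/n≡m g k) (m<n⇒m/n≡0 r<k) ⟩
    g + 0                 ≡⟨ +-identityʳ g ⟩
    g                     ∎
    where open ≡-Reasoning

  grid-< : ∀ {g r K} → g < K → r < k → g * k + r < k * K
  grid-< {g} {r} {K} g<K r<k = begin-strict
    g * k + r     <⟨ +-monoʳ-< (g * k) r<k ⟩
    g * k + k     ≡⟨ +-comm (g * k) k ⟩
    suc g * k     ≤⟨ *-monoˡ-≤ k g<K ⟩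
    K * k         ≡⟨ *-comm K k ⟩
    k * K         ∎
    where open ≤-Reasoning

  grid-%-injective : ∀ g h {r s} → r < k → s < k → g * k + r ≡ h * k + s → r ≡ s
  grid-%-injective g h r<k s<k e = trans (sym (grid-% g r<k)) (trans (%-congˡ e) (grid-% h s<k))

infix 4 _≼_ _≼?_

_≼_ : ∀ {k} → Vertex k → Vertex k → Set
_≼_ = Prefix _≡_

_≼?_ : ∀ {k} (u v : Vertex k) → Dec (u ≼ v)
_≼?_ = prefix? Fin._≟_

module _ {k : ℕ} where

  ≼-refl : ∀ {u : Vertex k} → u ≼ u
  ≼-refl = fromPointwise (Pointwise.refl refl)

  ≼-trans : ∀ {u v w : Vertex k} → u ≼ v → v ≼ w → u ≼ w
  ≼-trans = Prefix.trans trans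

  ≼-child : ∀ {u : Vertex k} {r} → u ≼ child u r
  ≼-child {r = r} = ≼-refl ++ᵖ [ r ]

  child-⋠ : ∀ (u : Vertex k) {r} → ¬ (child u r ≼ u)
  child-⋠ []      ()
  child-⋠ (_ ∷ u) (_ ∷ p) = child-⋠ u p

  child-⋠-root : ∀ (u : Vertex k) {r} → ¬ (child u r ≼ [])
  child-⋠-root []      ()
  child-⋠-root (_ ∷ _) ()

  ≼-child⁻ : ∀ (u : Vertex k) {r} {w} → w ≼ child u r → w ≡ child u r ⊎ w ≼ u
  ≼-child⁻ []      []          = inj₂ []
  ≼-child⁻ []      (refl ∷ []) = inj₁ refl
  ≼-child⁻ (_ ∷ u) []          = inj₂ []
  ≼-child⁻ (_ ∷ u) (refl ∷ p) with ≼-child⁻ u p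
  ... | inj₁ refl = inj₁ refl
  ... | inj₂ p′   = inj₂ (refl ∷ p′)

  child-≼-child : ∀ (u : Vertex k) {r s} → child u r ≼ child u s → r ≡ s
  child-≼-child u p with ≼-child⁻ u p
  ... | inj₁ e  = List.∷ʳ-injectiveʳ u u e
  ... | inj₂ p′ = ⊥-elim (child-⋠ u p′)

  ≼-child-≢ : ∀ {u v : Vertex k} {r s} → u ≢ v → child u r ≼ child v s → child u r ≼ v
  ≼-child-≢ {u} {v} u≢v p with ≼-child⁻ v p
  ... | inj₁ e  = ⊥-elim (u≢v (List.∷ʳ-injectiveˡ u v e))
  ... | inj₂ p′ = p′

  children-disjoint : ∀ (u : Vertex k) {r s w} → child u r ≼ w → child u s ≼ w → r ≡ s
  children-disjoint []      (refl ∷ _) (refl ∷ _) = refl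
  children-disjoint (_ ∷ u) (refl ∷ p) (refl ∷ q) = children-disjoint u p q

  ∑-𝟙-children-≤ : ∀ {q} {Q : Set q} (Q? : Dec Q) (u x : Vertex k) →
                   sum (λ s → 𝟙 (Q? ×-dec child u s ≼? x)) ≤ 𝟙 (Q? ×-dec u ≼? x)
  ∑-𝟙-children-≤ Q? u x with Q? ×-dec u ≼? x
  ... | yes _  = ∑-𝟙-unique (λ s → Q? ×-dec child u s ≼? x) (λ r s (_ , p) (_ , q) → children-disjoint u p q)
  ... | no ¬Qu = ≤-reflexive (∑-zero (λ s →
    𝟙-no (λ (q , p) → ¬Qu (q , ≼-trans ≼-child p)) (Q? ×-dec child u s ≼? x)))

  pathValue-acc : ∀ acc (ds : Vertex k) → pathValue acc ds ≡ acc * k ^ length ds + pathValue 0 ds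
  pathValue-acc acc []       = sym (trans (+-identityʳ _) (*-identityʳ acc))
  pathValue-acc acc (d ∷ ds) = begin
    pathValue (acc * k + toℕ d) ds                ≡⟨ pathValue-acc (acc * k + toℕ d) ds ⟩
    (acc * k + toℕ d) * K + pathValue 0 ds        ≡⟨ cong (_+ pathValue 0 ds) (*-distribʳ-+ K (acc * k) (toℕ d)) ⟩
    acc * k * K + toℕ d * K + pathValue 0 ds      ≡⟨ +-assoc (acc * k * K) _ _ ⟩
    acc * k * K + (toℕ d * K + pathValue 0 ds)    ≡⟨ cong₂ _+_ (*-assoc acc k K) (sym (pathValue-acc (toℕ d) ds)) ⟩
    acc * (k * K) + pathValue (toℕ d) ds          ∎
    where
    open ≡-Reasoning
    K = k ^ length ds

  index-∷ : ∀ d (ds : Vertex k) → index (d ∷ ds) ≡ toℕ d * k ^ length ds + index ds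
  index-∷ d ds = trans (cong suc (pathValue-acc (toℕ d) ds)) (sym (+-suc _ _))

  index-∷-≤ : ∀ d (ds : Vertex k) → index (d ∷ ds) ≤ suc (toℕ d) * k ^ length ds

  index-≤ : ∀ (ds : Vertex k) → index ds ≤ k ^ length ds
  index-≤ []       = ≤-refl
  index-≤ (d ∷ ds) = ≤-trans (index-∷-≤ d ds) (*-monoˡ-≤ (k ^ length ds) (Fin.toℕ<n d))

  index-∷-≤ d ds = begin
    index (d ∷ ds)                         ≡⟨ index-∷ d ds ⟩
    toℕ d * k ^ length ds + index ds       ≤⟨ +-monoʳ-≤ (toℕ d * k ^ length ds) (index-≤ ds) ⟩
    toℕ d * k ^ length ds + k ^ length ds  ≡⟨ +-comm (toℕ d * k ^ length ds) _ ⟩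
    suc (toℕ d) * k ^ length ds            ∎
    where open ≤-Reasoning

digitWeight : ∀ {k} → Vertex k → ℕ
digitWeight []       = 1
digitWeight (d ∷ ds) = suc (toℕ d) * digitWeight ds

module _ {k : ℕ} where

  digitWeight-pos : ∀ (ds : Vertex k) → 1 ≤ digitWeight ds
  digitWeight-pos []       = ≤-refl
  digitWeight-pos (d ∷ ds) = *-mono-≤ (s≤s (z≤n {toℕ d})) (digitWeight-pos ds)

  ≤-*-digitWeight : ∀ x (ds : Vertex k) → x ≤ x * digitWeight ds
  ≤-*-digitWeight x ds = ≤-trans (≤-reflexive (sym (*-identityʳ x))) (*-monoʳ-≤ x (digitWeight-pos ds))

  digitWeight-≤1 : ∀ (ds : Vertex k) → digitWeight ds ≤ 1 → index ds ≡ 1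
  digitWeight-≤1 []           _   = refl
  digitWeight-≤1 (zero ∷ ds)  w≤1 = trans (index-∷ zero ds) (digitWeight-≤1 ds (≤-trans (m≤m+n _ 0) w≤1))
  digitWeight-≤1 (suc d ∷ ds) w≤1 =
    ⊥-elim (<⇒≱ (≤-trans (s≤s (s≤s z≤n)) (≤-*-digitWeight (suc (suc (toℕ d))) ds)) w≤1)

mirror : ∀ {k} → Vertex k → Vertex k
mirror = map Fin.opposite

module _ {k : ℕ} where

  mirror-involutive : ∀ (v : Vertex k) → mirror (mirror v) ≡ v
  mirror-involutive []       = refl
  mirror-involutive (d ∷ ds) = cong₂ _∷_ (Fin.opposite-involutive d) (mirror-involutive ds)

  mirror-child : ∀ (v : Vertex k) r → mirror (child v r) ≡ child (mirror v) (Fin.opposite r)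
  mirror-child v r = List.map-++ Fin.opposite v [ r ]

index-mirror : ∀ {k} (v : Vertex k) → index v + index (mirror v) ≡ suc (k ^ length v)
index-mirror         []       = refl
index-mirror {suc k} (d ∷ ds) = begin
  index (d ∷ ds) + index (mirror (d ∷ ds))
    ≡⟨ cong₂ _+_ (index-∷ d ds) (trans (index-∷ (Fin.opposite d) (mirror ds))
         (cong (λ ℓ → toℕ (Fin.opposite d) * suc k ^ ℓ + index (mirror ds)) (List.length-map Fin.opposite ds))) ⟩
  (toℕ d * K + index ds) + (toℕ (Fin.opposite d) * K + index (mirror ds))
    ≡⟨ +-interchange (toℕ d * K) (index ds) _ _ ⟩
  (toℕ d * K + toℕ (Fin.opposite d) * K) + (index ds + index (mirror ds))
    ≡⟨ cong₂ _+_ (sym (*-distribʳ-+ K (toℕ d) _)) (index-mirror ds) ⟩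
  (toℕ d + toℕ (Fin.opposite d)) * K + suc K
    ≡⟨ cong (λ x → x * K + suc K) digits-sum ⟩
  k * K + suc K
    ≡⟨ trans (+-suc (k * K) K) (cong suc (+-comm (k * K) K)) ⟩
  suc (suc k * K) ∎
  where
  open ≡-Reasoning
  K = suc k ^ length ds
  digits-sum : toℕ d + toℕ (Fin.opposite d) ≡ k
  digits-sum = trans (cong (toℕ d +_) (Fin.opposite-prop d)) (m+[n∸m]≡n (s≤s⁻¹ (Fin.toℕ<n d)))

-- The index of the vertex (k-1)ᵐ (y-1) 0 … 0 of layer t + 1.
rightmostIndex : ℕ → ℕ → ℕ → ℕ → ℕ
rightmostIndex k zero    m       y = 1
rightmostIndex k (suc t) zero    y = (y ∸ 1) * k ^ t + 1
rightmostIndex k (suc t) (suc m) y = (k ∸ 1) * k ^ t + rightmostIndex k t m y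

rightmostIndex-label1 : ∀ k t → rightmostIndex k t 0 1 ≡ 1
rightmostIndex-label1 k zero    = refl
rightmostIndex-label1 k (suc t) = refl

rightmostIndex-closed : ∀ k .{{_ : NonZero k}} t m y → m < t →
  rightmostIndex k t m y ≡ 1 + (y ∸ 1) * k ^ (t ∸ m ∸ 1) + (k ^ t ∸ k ^ (t ∸ m))
rightmostIndex-closed k (suc t) zero    y _ = begin
  (y ∸ 1) * k ^ t + 1                              ≡⟨ +-comm _ 1 ⟩
  1 + (y ∸ 1) * k ^ t                              ≡⟨ +-identityʳ _ ⟨
  1 + (y ∸ 1) * k ^ t + 0                          ≡⟨ cong (1 + (y ∸ 1) * k ^ t +_) (n∸n≡0 (k ^ suc t)) ⟨
  1 + (y ∸ 1) * k ^ t + (k ^ suc t ∸ k ^ suc t)    ∎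
  where open ≡-Reasoning
rightmostIndex-closed k (suc t) (suc m) y (s≤s m<t) = begin
  (k ∸ 1) * K + rightmostIndex k t m y             ≡⟨ cong ((k ∸ 1) * K +_) (rightmostIndex-closed k t m y m<t) ⟩
  (k ∸ 1) * K + (1 + A + (K ∸ Z))                  ≡⟨ x∙yz≈y∙xz ((k ∸ 1) * K) (1 + A) (K ∸ Z) ⟩
  1 + A + ((k ∸ 1) * K + (K ∸ Z))                  ≡⟨ cong (1 + A +_) lower-digits ⟩
  1 + A + (k * K ∸ Z)                              ∎
  where
  open ≡-Reasoning
  K = k ^ t
  Z = k ^ (t ∸ m)
  A = (y ∸ 1) * k ^ (t ∸ m ∸ 1)
  lower-digits : (k ∸ 1) * K + (K ∸ Z) ≡ k * K ∸ Z
  lower-digits = begin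
    (k ∸ 1) * K + (K ∸ Z)      ≡⟨ +-comm _ (K ∸ Z) ⟩
    (K ∸ Z) + (k ∸ 1) * K      ≡⟨ +-∸-comm ((k ∸ 1) * K) (^-monoʳ-≤ k (m∸n≤m t m)) ⟨
    K + (k ∸ 1) * K ∸ Z        ≡⟨ cong (λ x → x * K ∸ Z) (suc-pred k) ⟩
    k * K ∸ Z                  ∎

mirror-rightmostIndex : ∀ k .{{_ : NonZero k}} n j q → j < n → 1 ≤ q →
  suc (k ^ n) ∸ rightmostIndex k n j q ≡ (k + 1 ∸ q) * k ^ (n ∸ 1 ∸ j)
mirror-rightmostIndex k n j (suc q) j<n _ = begin
  suc (k ^ n) ∸ rightmostIndex k n j (suc q)
    ≡⟨ cong (suc (k ^ n) ∸_) (rightmostIndex-closed k n j (suc q) j<n) ⟩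
  suc (k ^ n) ∸ (1 + q * k ^ (n ∸ j ∸ 1) + (k ^ n ∸ k ^ (n ∸ j)))
    ≡⟨ cong₂ (λ e e′ → k ^ n ∸ (q * k ^ e + (k ^ n ∸ k ^ e′))) n∸j∸1≡n∸1∸j n∸j≡1+n∸1∸j ⟩
  k ^ n ∸ (q * K + (k ^ n ∸ k * K))
    ≡⟨ cong (k ^ n ∸_) (+-comm (q * K) _) ⟩
  k ^ n ∸ ((k ^ n ∸ k * K) + q * K)
    ≡⟨ ∸-+-assoc (k ^ n) (k ^ n ∸ k * K) (q * K) ⟨
  k ^ n ∸ (k ^ n ∸ k * K) ∸ q * K
    ≡⟨ cong (_∸ q * K) (m∸[m∸n]≡n (subst (_≤ k ^ n) (cong (k ^_) n∸j≡1+n∸1∸j)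
                                           (^-monoʳ-≤ k (m∸n≤m n j)))) ⟩
  k * K ∸ q * K
    ≡⟨ *-distribʳ-∸ K k q ⟨
  (k ∸ q) * K
    ≡⟨ cong (λ x → (x ∸ suc q) * K) (+-comm 1 k) ⟩
  (k + 1 ∸ suc q) * K ∎
  where
  open ≡-Reasoning
  K = k ^ (n ∸ 1 ∸ j)
  n∸j∸1≡n∸1∸j : n ∸ j ∸ 1 ≡ n ∸ 1 ∸ j
  n∸j∸1≡n∸1∸j = trans (∸-+-assoc n j 1) (trans (cong (n ∸_) (+-comm j 1)) (sym (∸-+-assoc n 1 j)))
  n∸j≡1+n∸1∸j : n ∸ j ≡ suc (n ∸ 1 ∸ j)
  n∸j≡1+n∸1∸j = trans (+-∸-assoc 1 j<n) (cong suc (sym (∸-+-assoc n 1 j)))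

module _ {k : ℕ} where

  index-≤-leading : ∀ d (ds : Vertex k) {y} → suc (toℕ d) * digitWeight ds ≤ y →
                    index (d ∷ ds) ≤ (y ∸ 1) * k ^ length ds + 1
  index-≤-leading d ds {y} dw≤y with digitWeight ds ≤? 1
  ... | yes w≤1 = begin
    index (d ∷ ds)      ≡⟨ trans (index-∷ d ds) (cong (toℕ d * K +_) (digitWeight-≤1 ds w≤1)) ⟩
    toℕ d * K + 1       ≤⟨ +-monoˡ-≤ 1 (*-monoˡ-≤ K (∸-monoˡ-≤ 1
                             (≤-trans (≤-*-digitWeight (suc (toℕ d)) ds) dw≤y))) ⟩
    (y ∸ 1) * K + 1     ∎
    where
    open ≤-Reasoning
    K = k ^ length ds
  ... | no w≰1 = begin
    index (d ∷ ds)      ≤⟨ index-∷-≤ d ds ⟩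
    suc (toℕ d) * K     ≤⟨ *-monoˡ-≤ K (∸-monoˡ-≤ 1 2+d≤y) ⟩
    (y ∸ 1) * K         ≤⟨ m≤m+n _ 1 ⟩
    (y ∸ 1) * K + 1     ∎
    where
    open ≤-Reasoning
    K = k ^ length ds
    2+d≤y : suc (suc (toℕ d)) ≤ y
    2+d≤y = begin
      suc (suc (toℕ d))               ≤⟨ +-monoˡ-≤ (suc (toℕ d)) (s≤s (z≤n {toℕ d})) ⟩
      suc (toℕ d) + suc (toℕ d)       ≡⟨ cong (suc (toℕ d) +_) (+-identityʳ _) ⟨
      2 * suc (toℕ d)                 ≡⟨ *-comm 2 (suc (toℕ d)) ⟩
      suc (toℕ d) * 2                 ≤⟨ *-monoʳ-≤ (suc (toℕ d)) (≰⇒> w≰1) ⟩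
      suc (toℕ d) * digitWeight ds    ≤⟨ dw≤y ⟩
      y                               ∎

  index-≤-rightmostIndex : ∀ (p : Vertex k) m y → digitWeight p < suc y * k ^ m →
                           index p ≤ rightmostIndex k (length p) m y
  index-≤-rightmostIndex []       m       y _  = ≤-refl
  index-≤-rightmostIndex (d ∷ ds) zero    y w< =
    index-≤-leading d ds (s≤s⁻¹ (≤-trans w< (≤-reflexive (*-identityʳ (suc y)))))
  index-≤-rightmostIndex (d ∷ ds) (suc m) y w< with m≤n⇒m<n∨m≡n (Fin.toℕ<n d)
  ... | inj₁ 2+d≤k = begin
    index (d ∷ ds)                                   ≤⟨ index-∷-≤ d ds ⟩
    suc (toℕ d) * K                                  ≤⟨ *-monoˡ-≤ K (∸-monoˡ-≤ 1 2+d≤k) ⟩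
    (k ∸ 1) * K                                      ≤⟨ m≤m+n _ _ ⟩
    (k ∸ 1) * K + rightmostIndex k (length ds) m y   ∎
    where
    open ≤-Reasoning
    K = k ^ length ds
  ... | inj₂ 1+d≡k = begin
    index (d ∷ ds)                                   ≡⟨ index-∷ d ds ⟩
    toℕ d * K + index ds                             ≤⟨ +-mono-≤ (≤-reflexive (cong (λ x → (x ∸ 1) * K) 1+d≡k))
                                                                 (index-≤-rightmostIndex ds m y w<′) ⟩
    (k ∸ 1) * K + rightmostIndex k (length ds) m y   ∎
    where
    open ≤-Reasoning
    K = k ^ length ds
    w<′ : digitWeight ds < suc y * k ^ m
    w<′ = *-cancelˡ-< k _ _ (begin-strict
      k * digitWeight ds              ≡⟨ cong (_* digitWeight ds) 1+d≡k ⟨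
      suc (toℕ d) * digitWeight ds    <⟨ w< ⟩
      suc y * (k * k ^ m)             ≡⟨ *-assoc (suc y) k (k ^ m) ⟨
      suc y * k * k ^ m               ≡⟨ cong (_* k ^ m) (*-comm (suc y) k) ⟩
      k * suc y * k ^ m               ≡⟨ *-assoc k (suc y) (k ^ m) ⟩
      k * (suc y * k ^ m)             ∎)

-- Every reachable configuration is left-heavy

module SmallChips {k n : ℕ} (a : Fin (k ^ n)) where

  chipsBelow : Config k n → Vertex k → ℕ
  chipsBelow σ w = sum (λ b → 𝟙 (b Fin.≤? a ×-dec w ≼? σ b))

  LeftHeavy : Config k n → Set
  LeftHeavy σ = ∀ u {r s} → s Fin.≤ r → chipsBelow σ (child u r) ≤ chipsBelow σ (child u s)

  module _ {σ σ′ : Config k n} {v : Vertex k} {f : Fin k → Fin (k ^ n)}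
           (inc : ∀ r s → r Fin.< s → f r Fin.< f s) (at-v : ∀ r → σ (f r) ≡ v)
           (moved : ∀ b → (Σ (Fin k) λ r → f r ≡ b × σ′ b ≡ child v r)
                        ⊎ ((∀ r → f r ≢ b) × σ′ b ≡ σ b)) where

    chipsBelow-fired-child : ∀ r → chipsBelow σ′ (child v r) ≡ chipsBelow σ (child v r) + 𝟙 (f r Fin.≤? a)
    chipsBelow-fired-child r = begin
      sum (λ b → 𝟙 (b Fin.≤? a ×-dec child v r ≼? σ′ b))
        ≡⟨ sum-cong-≗ term ⟩
      sum (λ b → 𝟙 (b Fin.≤? a ×-dec child v r ≼? σ b) + 𝟙 (b Fin.≤? a ×-dec f r Fin.≟ b))
        ≡⟨ ∑-distrib-+ (λ b → 𝟙 (b Fin.≤? a ×-dec child v r ≼? σ b)) _ ⟩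
      chipsBelow σ (child v r) + sum (λ b → 𝟙 (b Fin.≤? a ×-dec f r Fin.≟ b))
        ≡⟨ cong (chipsBelow σ (child v r) +_) (∑-𝟙-≟ (Fin._≤? a) (f r)) ⟩
      chipsBelow σ (child v r) + 𝟙 (f r Fin.≤? a) ∎
      where
      open ≡-Reasoning
      term : ∀ b → 𝟙 (b Fin.≤? a ×-dec child v r ≼? σ′ b)
                 ≡ 𝟙 (b Fin.≤? a ×-dec child v r ≼? σ b) + 𝟙 (b Fin.≤? a ×-dec f r Fin.≟ b)
      term b with moved b
      ... | inj₁ (s , refl , σ′b) rewrite σ′b | at-v s = cong₂ _+_
            (sym (𝟙-no (λ (_ , p) → child-⋠ v p) (f s Fin.≤? a ×-dec child v r ≼? v)))
            (𝟙-cong (λ (le , p) → le , cong f (child-≼-child v p))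
                    (λ (le , e) → le , subst (λ t → child v r ≼ child v t) (increasing⇒injective inc e) ≼-refl)
                    (f s Fin.≤? a ×-dec child v r ≼? child v s) (f s Fin.≤? a ×-dec f r Fin.≟ f s))
      ... | inj₂ (unfired , σ′b) rewrite σ′b =
            sym (trans (cong (_ +_) (𝟙-no (λ (_ , e) → unfired r e) (b Fin.≤? a ×-dec f r Fin.≟ b)))
                       (+-identityʳ _))

    chipsBelow-unfired-child : ∀ {u} r → u ≢ v → chipsBelow σ′ (child u r) ≡ chipsBelow σ (child u r)
    chipsBelow-unfired-child {u} r u≢v = sum-cong-≗ term
      where
      term : ∀ b → 𝟙 (b Fin.≤? a ×-dec child u r ≼? σ′ b) ≡ 𝟙 (b Fin.≤? a ×-dec child u r ≼? σ b)
      term b with moved b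
      ... | inj₁ (s , refl , σ′b) rewrite σ′b | at-v s =
            𝟙-cong (λ (le , p) → le , ≼-child-≢ u≢v p) (λ (le , p) → le , ≼-trans p ≼-child) _ _
      ... | inj₂ (_ , σ′b) rewrite σ′b = refl

    -- Child r gains chip f r, which is small whenever the chip f s sent to a left sibling is.
    leftHeavy-fire : LeftHeavy σ → LeftHeavy σ′
    leftHeavy-fire heavy u {r} {s} s≤r with List.≡-dec Fin._≟_ u v
    ... | yes refl rewrite chipsBelow-fired-child r | chipsBelow-fired-child s =
          +-mono-≤ (heavy u s≤r) (𝟙-mono (Fin.≤-trans (increasing⇒monotone inc s≤r)) (f r Fin.≤? a) (f s Fin.≤? a))
    ... | no u≢v rewrite chipsBelow-unfired-child r u≢v | chipsBelow-unfired-child s u≢v = heavy u s≤r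

  chipsBelow-initial : ∀ u {r} → chipsBelow (initial k n) (child u r) ≡ 0
  chipsBelow-initial u {r} = ∑-zero {k ^ n} (λ b →
    𝟙-no (λ (_ , p) → child-⋠-root u p) (b Fin.≤? a ×-dec child u r ≼? []))

  leftHeavy-initial : LeftHeavy (initial k n)
  leftHeavy-initial u _ = ≤-reflexive (trans (chipsBelow-initial u) (sym (chipsBelow-initial u)))

  leftHeavy-reachable : ∀ {σ σ′} → Star (Fire k n) σ σ′ → LeftHeavy σ → LeftHeavy σ′
  leftHeavy-reachable ε                                      heavy = heavy
  leftHeavy-reachable ((_ , _ , inc , at-v , moved) ◅ steps) heavy =
    leftHeavy-reachable steps (leftHeavy-fire inc at-v moved heavy)

  children-≤-parent : ∀ σ u → sum (λ s → chipsBelow σ (child u s)) ≤ chipsBelow σ u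
  children-≤-parent σ u = begin
    sum (λ s → chipsBelow σ (child u s))
      ≡⟨ ∑-comm (λ s b → 𝟙 (b Fin.≤? a ×-dec child u s ≼? σ b)) ⟩
    sum (λ b → sum (λ s → 𝟙 (b Fin.≤? a ×-dec child u s ≼? σ b)))
      ≤⟨ ∑-mono-≤ (λ b → ∑-𝟙-children-≤ (b Fin.≤? a) u (σ b)) ⟩
    chipsBelow σ u ∎
    where open ≤-Reasoning

  module _ {σ : Config k n} (heavy : LeftHeavy σ) where

    child-bound : ∀ u r → suc (toℕ r) * chipsBelow σ (child u r) ≤ chipsBelow σ u
    child-bound u r = ≤-trans (*-≤-∑ (λ s → chipsBelow σ (child u s)) r (λ s s≤r → heavy u s≤r))
                              (children-≤-parent σ u)

    digitWeight-bound : ∀ ws u → digitWeight ws * chipsBelow σ (u ++ ws) ≤ chipsBelow σ u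
    digitWeight-bound []       u = ≤-reflexive (trans (*-identityˡ (chipsBelow σ (u ++ [])))
                                                      (cong (chipsBelow σ) (List.++-identityʳ u)))
    digitWeight-bound (d ∷ ws) u = begin
      suc (toℕ d) * digitWeight ws * chipsBelow σ (u ++ d ∷ ws)
        ≡⟨ trans (*-assoc (suc (toℕ d)) (digitWeight ws) _)
                 (cong (λ w → suc (toℕ d) * (digitWeight ws * chipsBelow σ w)) (sym (List.∷ʳ-++ u d ws))) ⟩
      suc (toℕ d) * (digitWeight ws * chipsBelow σ (child u d ++ ws))
        ≤⟨ *-monoʳ-≤ (suc (toℕ d)) (digitWeight-bound ws (child u d)) ⟩
      suc (toℕ d) * chipsBelow σ (child u d)
        ≤⟨ child-bound u d ⟩
      chipsBelow σ u ∎
      where open ≤-Reasoning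

  digitWeight-≤-label : ∀ {σ} → Star (Fire k n) (initial k n) σ → digitWeight (σ a) ≤ suc (toℕ a)
  digitWeight-≤-label {σ} steps = begin
    digitWeight (σ a)                          ≡⟨ *-identityʳ _ ⟨
    digitWeight (σ a) * 1                      ≤⟨ *-monoʳ-≤ (digitWeight (σ a)) a-below-itself ⟩
    digitWeight (σ a) * chipsBelow σ (σ a)     ≤⟨ digitWeight-bound (leftHeavy-reachable steps leftHeavy-initial) (σ a) [] ⟩
    chipsBelow σ []                            ≤⟨ ∑-mono-≤ (λ b → 𝟙-mono proj₁ (b Fin.≤? a ×-dec [] ≼? σ b)
                                                                           (b Fin.≤? a)) ⟩
    sum {k ^ n} (λ b → 𝟙 (b Fin.≤? a))         ≤⟨ ∑-𝟙-≤-bound (k ^ n) (toℕ a) ⟩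
    suc (toℕ a)                                ∎
    where
    open ≤-Reasoning
    a-below-itself : 1 ≤ chipsBelow σ (σ a)
    a-below-itself = ≤-trans (≤-reflexive (sym (𝟙-yes (Fin.≤-refl , ≼-refl) (a Fin.≤? a ×-dec σ a ≼? σ a))))
                             (term-≤-∑ (λ b → 𝟙 (b Fin.≤? a ×-dec σ a ≼? σ b)) a)

-- Realising firing strategies

module Firing {k n : ℕ} where

  fire : Config k n → Vertex k → (Fin k → Fin (k ^ n)) → Config k n
  fire σ v f b with Fin.any? (λ r → f r Fin.≟ b)
  ... | yes (r , _) = child v r
  ... | no _        = σ b

  fire-unfired : ∀ {σ v f b} → (∀ r → f r ≢ b) → fire σ v f b ≡ σ b
  fire-unfired {f = f} {b} unfired with Fin.any? (λ r → f r Fin.≟ b)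
  ... | yes (r , fr≡b) = ⊥-elim (unfired r fr≡b)
  ... | no _           = refl

  module _ {σ : Config k n} {v : Vertex k} {f : Fin k → Fin (k ^ n)}
           (inc : ∀ r s → r Fin.< s → f r Fin.< f s) where

    fire-fired : ∀ r → fire σ v f (f r) ≡ child v r
    fire-fired r with Fin.any? (λ s → f s Fin.≟ f r)
    ... | yes (s , fs≡fr) = cong (child v) (increasing⇒injective inc fs≡fr)
    ... | no none         = ⊥-elim (none (r , refl))

    fire-valid : (∀ r → σ (f r) ≡ v) → Fire k n σ (fire σ v f)
    fire-valid at-v = v , f , inc , at-v , moved
      where
      moved : ∀ b → (Σ (Fin k) λ r → f r ≡ b × fire σ v f b ≡ child v r)
                  ⊎ ((∀ r → f r ≢ b) × fire σ v f b ≡ σ b)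
      moved b with Fin.any? (λ r → f r Fin.≟ b)
      ... | yes (r , fr≡b) = inj₁ (r , fr≡b , refl)
      ... | no none        = inj₂ ((λ r fr≡b → none (r , fr≡b)) , refl)

-- How a vertex holding k^(t+1) chips, referred to by their ranks 0, 1, …, fires
-- them in k^t firings: the g-th firing sends the chip of rank `rank g r` to
-- child r, and the chip of rank i is sent in firing `group i` to child `branch i`.
record Node (k t : ℕ) : Set where
  field
    rank   : ℕ → Fin k → ℕ
    group  : ℕ → ℕ
    branch : ℕ → Fin k
    rank-<          : ∀ {g} r → g < k ^ t → rank g r < k ^ suc t
    rank-mono-child : ∀ {g r s} → g < k ^ t → r Fin.< s → rank g r < rank g s
    rank-mono-group : ∀ {g g′} r → g < g′ → g′ < k ^ t → rank g r < rank g′ r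
    group-rank      : ∀ {g} r → g < k ^ t → group (rank g r) ≡ g
    branch-rank     : ∀ {g} r → g < k ^ t → branch (rank g r) ≡ r
    group-<         : ∀ {i} → i < k ^ suc t → group i < k ^ t
    rank-group      : ∀ {i} → i < k ^ suc t → rank (group i) (branch i) ≡ i

infixr 5 _∷_

-- All vertices at the same depth use the same node.
data Strategy (k : ℕ) : ℕ → Set where
  []  : Strategy k zero
  _∷_ : ∀ {t} → Node k t → Strategy k t → Strategy k (suc t)

landing : ∀ {k t} → Strategy k t → ℕ → Vertex k
landing []      i = []
landing (P ∷ S) i = Node.branch P i ∷ landing S (Node.group P i)

landing-length : ∀ {k t} (S : Strategy k t) i → length (landing S i) ≡ t
landing-length []      i = refl
landing-length (P ∷ S) i = cong suc (landing-length S (Node.group P i))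

index-landing-∷ : ∀ {k t} (P : Node k t) S i →
  index (landing (P ∷ S) i) ≡ toℕ (Node.branch P i) * k ^ t + index (landing S (Node.group P i))
index-landing-∷ {k} P S i = trans (index-∷ (Node.branch P i) (landing S (Node.group P i)))
  (cong (λ ℓ → toℕ (Node.branch P i) * k ^ ℓ + index (landing S (Node.group P i)))
        (landing-length S (Node.group P i)))

landing-injective : ∀ {k t} (S : Strategy k t) {i j} → i < k ^ t → j < k ^ t →
                    landing S i ≡ landing S j → i ≡ j
landing-injective []      {zero}  {zero}  _        _        _ = refl
landing-injective []      {suc _}         (s≤s ()) _        _
landing-injective []      {j = suc _}     _        (s≤s ()) _
landing-injective (P ∷ S) {i} {j} i< j< e with List.∷-injective e
... | b≡ , rest = begin
  i                          ≡⟨ rank-group i< ⟨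
  rank (group i) (branch i)  ≡⟨ cong₂ rank (landing-injective S (group-< i<) (group-< j<) rest) b≡ ⟩
  rank (group j) (branch j)  ≡⟨ rank-group j< ⟩
  j                          ∎
  where
  open Node P
  open ≡-Reasoning

module Realisation {k n : ℕ} where

  open Firing {k} {n}

  AllAt : Config k n → Vertex k → ℕ → (ℕ → Fin (k ^ n)) → Set
  AllAt σ v M e = ∀ i → i < M → σ (e i) ≡ v

  Untouched : ℕ → (ℕ → Fin (k ^ n)) → Config k n → Config k n → Set
  Untouched M e σ σ′ = ∀ b → (∀ i → i < M → e i ≢ b) → σ′ b ≡ σ b

  Realises : ∀ {t} → Strategy k t → Vertex k → (ℕ → Fin (k ^ n)) → Config k n → Config k n → Set
  Realises {t} S v e σ σ′ =
    Star (Fire k n) σ σ′ × (∀ i → i < k ^ t → σ′ (e i) ≡ v ++ landing S i) × Untouched (k ^ t) e σ σ′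

  module AtNode {t} (P : Node k t) {v : Vertex k} {e : ℕ → Fin (k ^ n)} {σ : Config k n}
                (inc : IncreasingOn (k ^ suc t) e) (at : AllAt σ v (k ^ suc t) e) where

    open Node P

    FiredUpTo : ℕ → Config k n → Set
    FiredUpTo g σ₁ = Star (Fire k n) σ σ₁
      × (∀ i → i < k ^ suc t → group i < g → σ₁ (e i) ≡ child v (branch i))
      × (∀ i → i < k ^ suc t → g ≤ group i → σ₁ (e i) ≡ v)
      × Untouched (k ^ suc t) e σ σ₁

    fireGroups : ∀ g → g ≤ k ^ t → ∃ (FiredUpTo g)
    fireGroups zero    _  = σ , ε , (λ _ _ ()) , (λ i i< _ → at i i<) , (λ _ _ → refl)
    fireGroups (suc g) g< with fireGroups g (<⇒≤ g<)
    ... | σ₁ , steps , fired , waiting , untouched =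
      fire σ₁ v f , steps ◅◅ (fire-valid f-inc f-at-v ◅ ε) , fired′ , waiting′ , untouched′
      where
      f : Fin k → Fin (k ^ n)
      f r = e (rank g r)
      f-inc : ∀ r s → r Fin.< s → f r Fin.< f s
      f-inc r s r<s = inc (rank-mono-child g< r<s) (rank-< s g<)
      f-at-v : ∀ r → σ₁ (f r) ≡ v
      f-at-v r = waiting (rank g r) (rank-< r g<) (≤-reflexive (sym (group-rank r g<)))
      not-fired : ∀ {i} → i < k ^ suc t → group i ≢ g → ∀ r → f r ≢ e i
      not-fired i< gi≢g r fr≡ei =
        gi≢g (trans (cong group (sym (increasingOn⇒injective inc (rank-< r g<) i< fr≡ei))) (group-rank r g<))
      fired′ : ∀ i → i < k ^ suc t → group i < suc g → fire σ₁ v f (e i) ≡ child v (branch i)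
      fired′ i i< gi<1+g with m≤n⇒m<n∨m≡n (s≤s⁻¹ gi<1+g)
      ... | inj₁ gi<g = trans (fire-unfired (not-fired i< (<⇒≢ gi<g))) (fired i i< gi<g)
      ... | inj₂ gi≡g = begin
        fire σ₁ v f (e i)                            ≡⟨ cong (fire σ₁ v f ∘ e) (rank-group i<) ⟨
        fire σ₁ v f (e (rank (group i) (branch i)))  ≡⟨ cong (λ x → fire σ₁ v f (e (rank x (branch i)))) gi≡g ⟩
        fire σ₁ v f (f (branch i))                   ≡⟨ fire-fired f-inc (branch i) ⟩
        child v (branch i)                           ∎
        where open ≡-Reasoning
      waiting′ : ∀ i → i < k ^ suc t → suc g ≤ group i → fire σ₁ v f (e i) ≡ v
      waiting′ i i< g<gi = trans (fire-unfired (not-fired i< (>⇒≢ g<gi))) (waiting i i< (<⇒≤ g<gi))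
      untouched′ : Untouched (k ^ suc t) e σ (fire σ₁ v f)
      untouched′ b other = trans (fire-unfired (λ r → other (rank g r) (rank-< r g<))) (untouched b other)

    module Child (r : Fin k) where

      sentTo : ℕ → Fin (k ^ n)
      sentTo g = e (rank g r)

      sentTo-increasing : IncreasingOn (k ^ t) sentTo
      sentTo-increasing g<g′ g′<K = inc (rank-mono-group r g<g′ g′<K) (rank-< r g′<K)

      sentTo-group : ∀ {i} → i < k ^ suc t → branch i ≡ r → sentTo (group i) ≡ e i
      sentTo-group i< refl = cong e (rank-group i<)

      sentTo-other : ∀ {i} → i < k ^ suc t → branch i ≢ r → ∀ g → g < k ^ t → sentTo g ≢ e i
      sentTo-other i< bi≢r g g< sent≡ei =
        bi≢r (trans (cong branch (sym (increasingOn⇒injective inc (rank-< r g<) i< sent≡ei))) (branch-rank r g<))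

    module _ (S : Strategy k t)
             (realise-S : ∀ {v e σ} → IncreasingOn (k ^ t) e → AllAt σ v (k ^ t) e → ∃ (Realises S v e σ)) where

      Descended : ℕ → Config k n → Set
      Descended ρ σ₂ = Star (Fire k n) σ σ₂
        × (∀ i → i < k ^ suc t → toℕ (branch i) < ρ → σ₂ (e i) ≡ v ++ landing (P ∷ S) i)
        × (∀ i → i < k ^ suc t → ρ ≤ toℕ (branch i) → σ₂ (e i) ≡ child v (branch i))
        × Untouched (k ^ suc t) e σ σ₂

      descendInto : ∀ {ρ} (ρ<k : ρ < k) → ∃ (Descended ρ) → ∃ (Descended (suc ρ))
      descendInto {ρ} ρ<k (σ₂ , steps , done , pending , untouched) = extend (realise-S sentTo-increasing sentTo-at)
        where
        r = Fin.fromℕ< ρ<k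
        open Child r
        branch≡r : ∀ {i} → toℕ (branch i) ≡ ρ → branch i ≡ r
        branch≡r bi≡ρ = Fin.toℕ-injective (trans bi≡ρ (sym (Fin.toℕ-fromℕ< ρ<k)))
        sentTo-at : AllAt σ₂ (child v r) (k ^ t) sentTo
        sentTo-at g g< = trans (pending (rank g r) (rank-< r g<)
                                 (≤-reflexive (sym (trans (cong toℕ (branch-rank r g<)) (Fin.toℕ-fromℕ< ρ<k)))))
                               (cong (child v) (branch-rank r g<))
        extend : ∃ (Realises S (child v r) sentTo σ₂) → ∃ (Descended (suc ρ))
        extend (σ₃ , steps′ , landed , untouched′) = σ₃ , steps ◅◅ steps′ , done′ , pending′ , untouched″
          where
          elsewhere : ∀ {i} → i < k ^ suc t → toℕ (branch i) ≢ ρ → σ₃ (e i) ≡ σ₂ (e i)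
          elsewhere i< bi≢ρ =
            untouched′ _ (sentTo-other i< (λ bi≡r → bi≢ρ (trans (cong toℕ bi≡r) (Fin.toℕ-fromℕ< ρ<k))))
          done′ : ∀ i → i < k ^ suc t → toℕ (branch i) < suc ρ → σ₃ (e i) ≡ v ++ landing (P ∷ S) i
          done′ i i< bi<1+ρ with m≤n⇒m<n∨m≡n (s≤s⁻¹ bi<1+ρ)
          ... | inj₁ bi<ρ = trans (elsewhere i< (<⇒≢ bi<ρ)) (done i i< bi<ρ)
          ... | inj₂ bi≡ρ = begin
            σ₃ (e i)                            ≡⟨ cong σ₃ (sentTo-group i< (branch≡r bi≡ρ)) ⟨
            σ₃ (sentTo (group i))               ≡⟨ landed (group i) (group-< i<) ⟩
            child v r ++ landing S (group i)    ≡⟨ List.∷ʳ-++ v r (landing S (group i)) ⟩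
            v ++ r ∷ landing S (group i)        ≡⟨ cong (λ x → v ++ x ∷ landing S (group i)) (branch≡r bi≡ρ) ⟨
            v ++ landing (P ∷ S) i              ∎
            where open ≡-Reasoning
          pending′ : ∀ i → i < k ^ suc t → suc ρ ≤ toℕ (branch i) → σ₃ (e i) ≡ child v (branch i)
          pending′ i i< ρ<bi = trans (elsewhere i< (>⇒≢ ρ<bi)) (pending i i< (<⇒≤ ρ<bi))
          untouched″ : Untouched (k ^ suc t) e σ σ₃
          untouched″ b other = trans (untouched′ b (λ g g< → other (rank g r) (rank-< r g<))) (untouched b other)

      descend : ∀ ρ → ρ ≤ k → ∃ (Descended ρ)
      descend zero _ with fireGroups (k ^ t) ≤-refl
      ... | σ₁ , steps , fired , _ , untouched =
        σ₁ , steps , (λ _ _ ()) , (λ i i< _ → fired i i< (group-< i<)) , untouched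
      descend (suc ρ) ρ<k = descendInto ρ<k (descend ρ (<⇒≤ ρ<k))

  realise : ∀ {t} (S : Strategy k t) {v e σ} → IncreasingOn (k ^ t) e → AllAt σ v (k ^ t) e → ∃ (Realises S v e σ)
  realise []      {v} {σ = σ} _   at = σ , ε , (λ i i< → trans (at i i<) (sym (List.++-identityʳ v))) , (λ _ _ → refl)
  realise (P ∷ S)             inc at with AtNode.descend P inc at S (realise S) k ≤-refl
  ... | σ′ , steps , done , _ , untouched =
    σ′ , steps , (λ i i< → done i i< (Fin.toℕ<n (Node.branch P i))) , untouched

injective⇒stable : ∀ {k n} → 2 ≤ k → {σ : Config k n} → (∀ {b c} → σ b ≡ σ c → b ≡ c) → Stable k n σ
injective⇒stable (s≤s (s≤s z≤n)) σ-injective v f f-injective at-v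
  with f-injective zero (suc zero) (σ-injective (trans (at-v zero) (sym (at-v (suc zero)))))
... | ()

module _ {k n : ℕ} .{{_ : NonZero k}} where

  -- The reduction modulo kⁿ only makes the function total; ranks used are below kⁿ.
  chipOfRank : ℕ → Fin (k ^ n)
  chipOfRank i = Fin.fromℕ< (m%n<n i (k ^ n) {{m^n≢0 k n}})

  toℕ-chipOfRank : ∀ {i} → i < k ^ n → toℕ (chipOfRank i) ≡ i
  toℕ-chipOfRank i< = trans (Fin.toℕ-fromℕ< _) (m<n⇒m%n≡m {{m^n≢0 k n}} i<)

  chipOfRank-increasing : IncreasingOn (k ^ n) chipOfRank
  chipOfRank-increasing i<j j< = subst₂ _<_ (sym (toℕ-chipOfRank (<-trans i<j j<))) (sym (toℕ-chipOfRank j<)) i<j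

  realiseFromRoot : (S : Strategy k n) → ∃ λ σ → Star (Fire k n) (initial k n) σ × ∀ b → σ b ≡ landing S (toℕ b)
  realiseFromRoot S with Realisation.realise {k} {n} S {[]} {chipOfRank} {initial k n} chipOfRank-increasing (λ _ _ → refl)
  ... | σ , steps , landed , _ = σ , steps , position
    where
    position : ∀ b → σ b ≡ landing S (toℕ b)
    position b = begin
      σ b                          ≡⟨ cong σ (Fin.toℕ-injective (toℕ-chipOfRank (Fin.toℕ<n b))) ⟨
      σ (chipOfRank (toℕ b))       ≡⟨ landed (toℕ b) (Fin.toℕ<n b) ⟩
      landing S (toℕ b)            ∎
      where open ≡-Reasoning

canLand-landing : ∀ {k n} → 2 ≤ k → (S : Strategy k n) (a : Fin (k ^ n)) →
                  CanLand k n a (index (landing S (toℕ a)))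
canLand-landing {k} {n} 2≤k@(s≤s (s≤s z≤n)) S a with realiseFromRoot {k} {n} S
... | σ , steps , position =
  σ , steps , injective⇒stable {n = n} 2≤k σ-injective ,
  trans (cong length (position a)) (landing-length S (toℕ a)) , cong index (position a)
  where
  σ-injective : ∀ {b c} → σ b ≡ σ c → b ≡ c
  σ-injective {b} {c} e = Fin.toℕ-injective
    (landing-injective S (Fin.toℕ<n b) (Fin.toℕ<n c) (trans (sym (position b)) (trans e (position c))))

-- Position g * k + r of the grid stands for child r of firing g; the chip fired
-- there has rank τ (g * k + r), so τ must increase along rows and columns.
record GridPermutation (k t : ℕ) : Set where
  field
    τ τ⁻¹         : ℕ → ℕ
    τ-<           : ∀ {p} → p < k ^ suc t → τ p < k ^ suc t
    τ⁻¹-<         : ∀ {i} → i < k ^ suc t → τ⁻¹ i < k ^ suc t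
    τ⁻¹-τ         : ∀ {p} → p < k ^ suc t → τ⁻¹ (τ p) ≡ p
    τ-τ⁻¹         : ∀ {i} → i < k ^ suc t → τ (τ⁻¹ i) ≡ i
    τ-mono-row    : ∀ {g r} → g < k ^ t → suc r < k → τ (g * k + r) < τ (g * k + suc r)
    τ-mono-column : ∀ {g r} → suc g < k ^ t → r < k → τ (g * k + r) < τ (suc g * k + r)

module _ {k t : ℕ} .{{_ : NonZero k}} (G : GridPermutation k t) where

  open GridPermutation G

  τ-mono-along-row : ∀ {g r s} → g < k ^ t → r < s → s < k → τ (g * k + r) < τ (g * k + s)
  τ-mono-along-row {s = suc s} g< r<1+s 1+s<k with m≤n⇒m<n∨m≡n (s≤s⁻¹ r<1+s)
  ... | inj₁ r<s  = <-trans (τ-mono-along-row g< r<s (<-trans (n<1+n s) 1+s<k)) (τ-mono-row g< 1+s<k)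
  ... | inj₂ refl = τ-mono-row g< 1+s<k

  τ-mono-along-column : ∀ {g h r} → g < h → h < k ^ t → r < k → τ (g * k + r) < τ (h * k + r)
  τ-mono-along-column {h = suc h} g<1+h 1+h<K r<k with m≤n⇒m<n∨m≡n (s≤s⁻¹ g<1+h)
  ... | inj₁ g<h  = <-trans (τ-mono-along-column g<h (<-trans (n<1+n h) 1+h<K) r<k) (τ-mono-column 1+h<K r<k)
  ... | inj₂ refl = τ-mono-column 1+h<K r<k

  gridNode : Node k t
  gridNode = record
    { rank            = λ g r → τ (g * k + toℕ r)
    ; group           = λ i → τ⁻¹ i / k
    ; branch          = λ i → Fin.fromℕ< (m%n<n (τ⁻¹ i) k)
    ; rank-<          = λ r g< → τ-< (grid-< g< (Fin.toℕ<n r))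
    ; rank-mono-child = λ {_} {_} {s} g< r<s → τ-mono-along-row g< r<s (Fin.toℕ<n s)
    ; rank-mono-group = λ r g<h h< → τ-mono-along-column g<h h< (Fin.toℕ<n r)
    ; group-rank      = λ {g} r g< → trans (cong (_/ k) (τ⁻¹-τ (grid-< g< (Fin.toℕ<n r)))) (grid-/ g (Fin.toℕ<n r))
    ; branch-rank     = λ {g} r g< → Fin.toℕ-injective (trans (Fin.toℕ-fromℕ< _)
                          (trans (cong (_% k) (τ⁻¹-τ (grid-< g< (Fin.toℕ<n r)))) (grid-% g (Fin.toℕ<n r))))
    ; group-<         = λ {i} i< → m<n*o⇒m/o<n (subst (τ⁻¹ i <_) (*-comm k (k ^ t)) (τ⁻¹-< i<))
    ; rank-group      = λ {i} i< → trans (cong τ (position i)) (τ-τ⁻¹ i<)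
    }
    where
    position : ∀ i → τ⁻¹ i / k * k + toℕ (Fin.fromℕ< (m%n<n (τ⁻¹ i) k)) ≡ τ⁻¹ i
    position i = begin
      τ⁻¹ i / k * k + toℕ (Fin.fromℕ< (m%n<n (τ⁻¹ i) k))  ≡⟨ cong (τ⁻¹ i / k * k +_) (Fin.toℕ-fromℕ< _) ⟩
      τ⁻¹ i / k * k + τ⁻¹ i % k                           ≡⟨ +-comm _ (τ⁻¹ i % k) ⟩
      τ⁻¹ i % k + τ⁻¹ i / k * k                           ≡⟨ m≡m%n+[m/n]*n (τ⁻¹ i) k ⟨
      τ⁻¹ i                                               ∎
      where open ≡-Reasoning

-- rotate A B puts the chip of rank B at position A and moves the chips of ranks
-- A, …, B - 1 one position later; unrotate is its inverse.
module Rotation (A B : ℕ) (A≤B : A ≤ B) where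

  rotate : ℕ → ℕ
  rotate p = if does (p ≟ A) then B else if does (A <? p) ∧ does (p ≤? B) then pred p else p

  unrotate : ℕ → ℕ
  unrotate i = if does (i ≟ B) then A else if does (A ≤? i) ∧ does (i <? B) then suc i else i

  rotate-below : ∀ {p} → p < A → rotate p ≡ p
  rotate-below {p} p<A rewrite dec-false (p ≟ A) (<⇒≢ p<A) | dec-false (A <? p) (<⇒≯ p<A) = refl

  rotate-at : rotate A ≡ B
  rotate-at rewrite dec-true (A ≟ A) refl = refl

  rotate-inside : ∀ {p} → A < p → p ≤ B → rotate p ≡ pred p
  rotate-inside {p} A<p p≤B
    rewrite dec-false (p ≟ A) (>⇒≢ A<p) | dec-true (A <? p) A<p | dec-true (p ≤? B) p≤B = refl

  rotate-above : ∀ {p} → B < p → rotate p ≡ p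
  rotate-above {p} B<p
    rewrite dec-false (p ≟ A) (>⇒≢ (≤-<-trans A≤B B<p)) | dec-true (A <? p) (≤-<-trans A≤B B<p)
          | dec-false (p ≤? B) (<⇒≱ B<p) = refl

  unrotate-below : ∀ {i} → i < A → unrotate i ≡ i
  unrotate-below {i} i<A rewrite dec-false (i ≟ B) (<⇒≢ (<-≤-trans i<A A≤B)) | dec-false (A ≤? i) (<⇒≱ i<A) = refl

  unrotate-inside : ∀ {i} → A ≤ i → i < B → unrotate i ≡ suc i
  unrotate-inside {i} A≤i i<B
    rewrite dec-false (i ≟ B) (<⇒≢ i<B) | dec-true (A ≤? i) A≤i | dec-true (i <? B) i<B = refl

  unrotate-at : unrotate B ≡ A
  unrotate-at rewrite dec-true (B ≟ B) refl = refl

  unrotate-above : ∀ {i} → B < i → unrotate i ≡ i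
  unrotate-above {i} B<i
    rewrite dec-false (i ≟ B) (>⇒≢ B<i) | dec-true (A ≤? i) (<⇒≤ (≤-<-trans A≤B B<i))
          | dec-false (i <? B) (<⇒≯ B<i) = refl

  unrotate-rotate : ∀ p → unrotate (rotate p) ≡ p
  unrotate-rotate p with <-cmp p A | p ≤? B
  ... | tri< p<A _ _  | _       rewrite rotate-below p<A = unrotate-below p<A
  ... | tri≈ _ refl _ | _       rewrite rotate-at = unrotate-at
  ... | tri> _ _ A<p  | yes p≤B rewrite rotate-inside A<p p≤B = inside A<p p≤B
    where
    inside : ∀ {p} → A < p → p ≤ B → unrotate (pred p) ≡ p
    inside {suc p} (s≤s A≤p) 1+p≤B = unrotate-inside A≤p 1+p≤B
  ... | tri> _ _ A<p  | no p≰B  rewrite rotate-above (≰⇒> p≰B) = unrotate-above (≰⇒> p≰B)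

  rotate-unrotate : ∀ i → rotate (unrotate i) ≡ i
  rotate-unrotate i with <-cmp i B | i <? A
  ... | tri< _ _ _    | yes i<A rewrite unrotate-below i<A = rotate-below i<A
  ... | tri< i<B _ _  | no i≮A  rewrite unrotate-inside (≮⇒≥ i≮A) i<B = rotate-inside (s≤s (≮⇒≥ i≮A)) i<B
  ... | tri≈ _ refl _ | _       rewrite unrotate-at = rotate-at
  ... | tri> _ _ B<i  | _       rewrite unrotate-above B<i = rotate-above B<i

  rotate-≤ : ∀ {p} → p ≢ A → rotate p ≤ p
  rotate-≤ {p} p≢A with <-cmp p A | p ≤? B
  ... | tri< p<A _ _ | _       = ≤-reflexive (rotate-below p<A)
  ... | tri≈ _ p≡A _ | _       = ⊥-elim (p≢A p≡A)
  ... | tri> _ _ A<p | yes p≤B = ≤-trans (≤-reflexive (rotate-inside A<p p≤B)) pred[n]≤n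
  ... | tri> _ _ A<p | no p≰B  = ≤-reflexive (rotate-above (≰⇒> p≰B))

  rotate-≥ : ∀ {p} → A < p → pred p ≤ rotate p
  rotate-≥ {p} A<p with p ≤? B
  ... | yes p≤B = ≤-reflexive (sym (rotate-inside A<p p≤B))
  ... | no p≰B  = ≤-trans pred[n]≤n (≤-reflexive (sym (rotate-above (≰⇒> p≰B))))

  rotate-mono : ∀ {p q} → p < q → p ≢ A → q ≢ A → rotate p < rotate q
  rotate-mono {p} {q} p<q p≢A q≢A with <-cmp p A | <-cmp q A
  ... | tri≈ _ p≡A _ | _            = ⊥-elim (p≢A p≡A)
  ... | _            | tri≈ _ q≡A _ = ⊥-elim (q≢A q≡A)
  ... | tri< p<A _ _ | tri< q<A _ _ rewrite rotate-below p<A | rotate-below q<A = p<q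
  ... | tri< p<A _ _ | tri> _ _ A<q = <-≤-trans (≤-<-trans (≤-reflexive (rotate-below p<A)) p<A)
                                                (≤-trans (<⇒≤pred A<q) (rotate-≥ A<q))
  ... | tri> _ _ A<p | tri< q<A _ _ = ⊥-elim (<-asym (<-trans A<p p<q) q<A)
  ... | tri> _ _ A<p | tri> _ _ A<q with q ≤? B
  ...   | yes q≤B rewrite rotate-inside A<q q≤B | rotate-inside A<p (≤-trans (<⇒≤ p<q) q≤B) =
          pred-mono-< {{>-nonZero (≤-<-trans z≤n A<p)}} p<q
  ...   | no q≰B  rewrite rotate-above (≰⇒> q≰B) = ≤-<-trans (rotate-≤ p≢A) p<q

module _ {k : ℕ} .{{_ : NonZero k}} where

  rotationGrid : ∀ t h B → h * k + pred k ≤ B → B < h * k + pred k + k → B < k ^ suc t → GridPermutation k t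
  rotationGrid t h B A≤B B<A+k B<M = record
    { τ             = rotate
    ; τ⁻¹           = unrotate
    ; τ-<           = rotate-<
    ; τ⁻¹-<         = unrotate-<
    ; τ⁻¹-τ         = λ {p} _ → unrotate-rotate p
    ; τ-τ⁻¹         = λ {i} _ → rotate-unrotate i
    ; τ-mono-row    = mono-row
    ; τ-mono-column = mono-column
    }
    where
    A = h * k + pred k
    open Rotation A B A≤B

    rotate-< : ∀ {p} → p < k ^ suc t → rotate p < k ^ suc t
    rotate-< {p} p<M with p ≟ A
    ... | yes refl = subst (_< k ^ suc t) (sym rotate-at) B<M
    ... | no p≢A   = ≤-<-trans (rotate-≤ p≢A) p<M

    unrotate-< : ∀ {i} → i < k ^ suc t → unrotate i < k ^ suc t
    unrotate-< {i} i<M with <-cmp i B | i <? A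
    ... | tri< _ _ _    | yes i<A rewrite unrotate-below i<A = i<M
    ... | tri< i<B _ _  | no i≮A  rewrite unrotate-inside (≮⇒≥ i≮A) i<B = ≤-<-trans i<B B<M
    ... | tri≈ _ refl _ | _       rewrite unrotate-at = ≤-<-trans A≤B B<M
    ... | tri> _ _ B<i  | _       rewrite unrotate-above B<i = i<M

    -- A is the last position of its row, so it never sits left of another position in a row
    mono-row : ∀ {g r} → g < k ^ t → suc r < k → rotate (g * k + r) < rotate (g * k + suc r)
    mono-row {g} {r} _ 1+r<k with (g * k + suc r) ≟ A
    ... | yes q≡A rewrite q≡A | rotate-at | rotate-below (≤-reflexive (trans (sym (+-suc (g * k) r)) q≡A)) =
          <-≤-trans (≤-reflexive (trans (sym (+-suc (g * k) r)) q≡A)) A≤B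
    ... | no q≢A = rotate-mono (≤-reflexive (sym (+-suc (g * k) r))) p≢A q≢A
      where
      p≢A : g * k + r ≢ A
      p≢A p≡A = <-irrefl (grid-%-injective g h (<-trans (n<1+n r) 1+r<k) (pred[n]<n k) p≡A) (<⇒≤pred 1+r<k)

    <+k : ∀ p → p < p + k
    <+k p = m<m+n p (>-nonZero⁻¹ k)

    next-row : ∀ g r → suc g * k + r ≡ g * k + r + k
    next-row g r = trans (cong (_+ r) (+-comm k (g * k))) (trans (+-assoc (g * k) k r)
                     (trans (cong (g * k +_) (+-comm k r)) (sym (+-assoc (g * k) r k))))

    mono-column : ∀ {g r} → suc g < k ^ t → r < k → rotate (g * k + r) < rotate (suc g * k + r)
    mono-column {g} {r} _ _ rewrite next-row g r with (g * k + r) ≟ A | (g * k + r + k) ≟ A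
    ... | yes p≡A | _       rewrite p≡A | rotate-at | rotate-above B<A+k = B<A+k
    ... | no _    | yes q≡A rewrite q≡A | rotate-at | rotate-below (<-≤-trans (<+k (g * k + r)) (≤-reflexive q≡A)) =
          <-≤-trans (<-≤-trans (<+k (g * k + r)) (≤-reflexive q≡A)) A≤B
    ... | no p≢A  | no q≢A  = rotate-mono (<+k (g * k + r)) p≢A q≢A

  rotationNode : ∀ t h B → h * k + pred k ≤ B → B < h * k + pred k + k → B < k ^ suc t → Node k t
  rotationNode t h B A≤B B<A+k B<M = gridNode (rotationGrid t h B A≤B B<A+k B<M)

  module _ {t h B} (A≤B : h * k + pred k ≤ B) (B<A+k : B < h * k + pred k + k) (B<M : B < k ^ suc t)
           (S : Strategy k t) where

    open Rotation (h * k + pred k) B A≤B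

    index-landing-rotation-B :
      index (landing (rotationNode t h B A≤B B<A+k B<M ∷ S) B) ≡ pred k * k ^ t + index (landing S h)
    index-landing-rotation-B = trans (index-landing-∷ (rotationNode t h B A≤B B<A+k B<M) S B)
      (cong₂ (λ d g → d * k ^ t + index (landing S g))
             (trans (Fin.toℕ-fromℕ< _) (trans (cong (_% k) unrotate-at) (grid-% h (pred[n]<n k))))
             (trans (cong (_/ k) unrotate-at) (grid-/ h (pred[n]<n k))))

    index-landing-rotation-< : ∀ {i} → i < k → i < h * k + pred k →
      index (landing (rotationNode t h B A≤B B<A+k B<M ∷ S) i) ≡ i * k ^ t + index (landing S 0)
    index-landing-rotation-< {i} i<k i<A = trans (index-landing-∷ (rotationNode t h B A≤B B<A+k B<M) S i)
      (cong₂ (λ d g → d * k ^ t + index (landing S g))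
             (trans (Fin.toℕ-fromℕ< _) (trans (cong (_% k) (unrotate-below i<A)) (m<n⇒m%n≡m i<k)))
             (trans (cong (_/ k) (unrotate-below i<A)) (m<n⇒m/n≡0 i<k)))

-- The rightmost landing vertex

module _ {k : ℕ} .{{_ : NonZero k}} where

  module _ {i} (k≤c : k ≤ suc i) where

    c/k∸1-suc : suc (suc i / k ∸ 1) ≡ suc i / k
    c/k∸1-suc = m+[n∸m]≡n (m≥n⇒m/n>0 k≤c)

    lastOfFiring-suc : suc ((suc i / k ∸ 1) * k + pred k) ≡ suc i / k * k
    lastOfFiring-suc = begin
      suc ((q ∸ 1) * k + pred k)   ≡⟨ +-suc _ (pred k) ⟨
      (q ∸ 1) * k + suc (pred k)   ≡⟨ cong ((q ∸ 1) * k +_) (suc-pred k) ⟩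
      (q ∸ 1) * k + k              ≡⟨ +-comm _ k ⟩
      suc (q ∸ 1) * k              ≡⟨ cong (_* k) c/k∸1-suc ⟩
      q * k                        ∎
      where
      open ≡-Reasoning
      q = suc i / k

    lastOfFiring-≤ : (suc i / k ∸ 1) * k + pred k ≤ i
    lastOfFiring-≤ = s≤s⁻¹ (subst (_≤ suc i) (sym lastOfFiring-suc) (m/n*n≤m (suc i) k))

    <-lastOfFiring+k : i < (suc i / k ∸ 1) * k + pred k + k
    <-lastOfFiring+k = s≤s⁻¹ (begin-strict
      suc i                                    <⟨ c<[1+c/k]*k (suc i) ⟩
      k + suc i / k * k                        ≡⟨ +-comm k _ ⟩
      suc i / k * k + k                        ≡⟨ cong (_+ k) lastOfFiring-suc ⟨
      suc ((suc i / k ∸ 1) * k + pred k) + k   ∎)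
      where open ≤-Reasoning

    c/k∸1-< : ∀ {t} → i < k ^ suc t → suc i / k ∸ 1 < k ^ t
    c/k∸1-< {t} i<M = subst (_≤ k ^ t) (sym c/k∸1-suc) (*-cancelʳ-≤ (suc i / k) (k ^ t) k (begin
      suc i / k * k     ≤⟨ m/n*n≤m (suc i) k ⟩
      suc i             ≤⟨ i<M ⟩
      k * k ^ t         ≡⟨ *-comm k (k ^ t) ⟩
      k ^ t * k         ∎))
      where open ≤-Reasoning

  -- The chip of rank i, i.e. of label c = i + 1, goes to the last child in firing
  -- ⌊c/k⌋ - 1, where it gets rank ⌊c/k⌋ - 1; if c < k it goes to child i of the
  -- first firing and gets rank 0.
  rightmostStrategy : ∀ t i → i < k ^ t → Strategy k t
  rightmostStrategy zero    i _   = []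
  rightmostStrategy (suc t) i i<M with k ≤? suc i
  ... | yes k≤c = rotationNode t (suc i / k ∸ 1) i (lastOfFiring-≤ k≤c) (<-lastOfFiring+k k≤c) i<M
                  ∷ rightmostStrategy t (suc i / k ∸ 1) (c/k∸1-< k≤c {t} i<M)
  ... | no _    = rotationNode t 0 (pred k) ≤-refl (m<m+n (pred k) (>-nonZero⁻¹ k)) (pred[k]<k^[1+t] t)
                  ∷ rightmostStrategy t 0 (m^n>0 k t)

  rightmostStrategy-landing : 1 < k → ∀ t i (i<M : i < k ^ t) {m y} →
    IsFloorLog k (suc i) m → IsFloorDiv (suc i) (k ^ m) y →
    index (landing (rightmostStrategy t i i<M) i) ≡ rightmostIndex k t m y
  rightmostStrategy-landing 1<k zero    i i<M log div = refl
  rightmostStrategy-landing 1<k (suc t) i i<M {m} {y} log div with k ≤? suc i | m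
  ... | yes k≤c | zero  = ⊥-elim (<⇒≱ (subst (suc i <_) (*-identityʳ k) (proj₂ log)) k≤c)
  ... | yes k≤c | suc m = begin
    index (landing (P ∷ S) i)                  ≡⟨ index-landing-rotation-B A≤B B<A+k i<M S ⟩
    pred k * k ^ t + index (landing S h)       ≡⟨ cong (pred k * k ^ t +_)
                                                       (rightmostStrategy-landing 1<k t h h<K log′ div′) ⟩
    pred k * k ^ t + rightmostIndex k t m y    ∎
    where
    open ≡-Reasoning
    h = suc i / k ∸ 1
    A≤B = lastOfFiring-≤ k≤c
    B<A+k = <-lastOfFiring+k k≤c
    h<K = c/k∸1-< k≤c {t} i<M
    P = rotationNode t h i A≤B B<A+k i<M
    S = rightmostStrategy t h h<K
    log′ : IsFloorLog k (suc h) m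
    log′ = subst (λ c → IsFloorLog k c m) (sym (c/k∸1-suc k≤c)) (floorLog-/ {m = m} log)
    div′ : IsFloorDiv (suc h) (k ^ m) y
    div′ = subst (λ c → IsFloorDiv c (k ^ m) y) (sym (c/k∸1-suc k≤c)) (floorDiv-/ {m = m} {y} div)
  ... | no k≰c | suc m = ⊥-elim (k≰c (≤-trans (m≤m*n k (k ^ m) {{m^n≢0 k m}}) (proj₁ log)))
  ... | no k≰c | zero  = begin
    index (landing (P ∷ S) i)             ≡⟨ index-landing-rotation-< {h = 0} ≤-refl B<A+k B<M S i<k i<A ⟩
    i * k ^ t + index (landing S 0)       ≡⟨ cong (i * k ^ t +_) (rightmostStrategy-landing 1<k t 0 (m^n>0 k t) log₁ div₁) ⟩
    i * k ^ t + rightmostIndex k t 0 1    ≡⟨ cong₂ (λ x z → (x ∸ 1) * k ^ t + z) (sym y≡c)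
                                                   (rightmostIndex-label1 k t) ⟩
    (y ∸ 1) * k ^ t + 1                   ∎
    where
    open ≡-Reasoning
    B<A+k = m<m+n (pred k) (>-nonZero⁻¹ k)
    B<M = pred[k]<k^[1+t] t
    P = rotationNode t 0 (pred k) ≤-refl B<A+k B<M
    S = rightmostStrategy t 0 (m^n>0 k t)
    i<k : i < k
    i<k = <-trans (n<1+n i) (≰⇒> k≰c)
    i<A : i < pred k
    i<A = <⇒≤pred (≰⇒> k≰c)
    y≡c : y ≡ suc i
    y≡c = ≤-antisym (subst (_≤ suc i) (*-identityʳ y) (proj₁ div))
                    (s≤s⁻¹ (subst (suc i <_) (*-identityʳ (suc y)) (proj₂ div)))
    log₁ : IsFloorLog k 1 0
    log₁ = ≤-refl , subst (1 <_) (sym (*-identityʳ k)) 1<k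
    div₁ : IsFloorDiv 1 1 1
    div₁ = ≤-refl , s≤s (s≤s z≤n)

rightmost : ∀ {k n} → 2 ≤ k → (a : Fin (k ^ n)) → ∀ {m y} →
            IsFloorLog k (suc (toℕ a)) m → IsFloorDiv (suc (toℕ a)) (k ^ m) y →
            IsRightmost k n a (rightmostIndex k n m y)
rightmost {k} {n} 2≤k@(s≤s (s≤s z≤n)) a {m} {y} log div = reached , bounded
  where
  reached : CanLand k n a (rightmostIndex k n m y)
  reached = subst (CanLand k n a) (rightmostStrategy-landing 2≤k n (toℕ a) (Fin.toℕ<n a) log div)
                  (canLand-landing 2≤k (rightmostStrategy n (toℕ a) (Fin.toℕ<n a)) a)
  bounded : ∀ i → CanLand k n a i → i ≤ rightmostIndex k n m y
  bounded i (σ , steps , _ , length≡n , index≡i) = subst₂ (λ ℓ j → j ≤ rightmostIndex k ℓ m y) length≡n index≡i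
    (index-≤-rightmostIndex (σ a) m y (≤-<-trans (SmallChips.digitWeight-≤-label {k} {n} a steps) (proj₂ div)))

-- Mirror symmetry

module Mirror {k n : ℕ} where

  mirrorConfig : Config k n → Config k n
  mirrorConfig σ b = mirror (σ (Fin.opposite b))

  fire-mirror : ∀ {σ σ′} → Fire k n σ σ′ → Fire k n (mirrorConfig σ) (mirrorConfig σ′)
  fire-mirror {σ} {σ′} (v , f , inc , at-v , moved) = mirror v , f′ , inc′ , at′ , moved′
    where
    f′ : Fin k → Fin (k ^ n)
    f′ r = Fin.opposite (f (Fin.opposite r))
    inc′ : ∀ r s → r Fin.< s → f′ r Fin.< f′ s
    inc′ r s r<s = opposite-< (inc (Fin.opposite s) (Fin.opposite r) (opposite-< r<s))
    at′ : ∀ r → mirrorConfig σ (f′ r) ≡ mirror v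
    at′ r = cong mirror (trans (cong σ (Fin.opposite-involutive _)) (at-v (Fin.opposite r)))
    moved′ : ∀ b → (Σ (Fin k) λ r → f′ r ≡ b × mirrorConfig σ′ b ≡ child (mirror v) r)
                 ⊎ ((∀ r → f′ r ≢ b) × mirrorConfig σ′ b ≡ mirrorConfig σ b)
    moved′ b with moved (Fin.opposite b)
    ... | inj₁ (r , fr≡b′ , σ′b′≡) = inj₁ (Fin.opposite r ,
          trans (cong (Fin.opposite ∘ f) (Fin.opposite-involutive r))
                (trans (cong Fin.opposite fr≡b′) (Fin.opposite-involutive b)) ,
          trans (cong mirror σ′b′≡) (mirror-child v r))
    ... | inj₂ (unfired , σ′b′≡) = inj₂ ((λ r f′r≡b → unfired (Fin.opposite r)
          (trans (sym (Fin.opposite-involutive _)) (cong Fin.opposite f′r≡b))) , cong mirror σ′b′≡)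

  stable-mirror : ∀ {σ} → Stable k n σ → Stable k n (mirrorConfig σ)
  stable-mirror {σ} stable v f f-injective at-v =
    stable (mirror v) (Fin.opposite ∘ f)
      (λ r s e → f-injective r s (trans (sym (Fin.opposite-involutive _))
                                        (trans (cong Fin.opposite e) (Fin.opposite-involutive _))))
      (λ r → trans (sym (mirror-involutive (σ (Fin.opposite (f r))))) (cong mirror (at-v r)))

  canLand-mirror : ∀ {a i} → CanLand k n a i → CanLand k n (Fin.opposite a) (suc (k ^ n) ∸ i)
  canLand-mirror {a} {i} (σ , steps , stable , length≡n , index≡i) =
    mirrorConfig σ , Star.gmap mirrorConfig fire-mirror steps , stable-mirror {σ} stable , length′ , index′
    where
    at-a : mirrorConfig σ (Fin.opposite a) ≡ mirror (σ a)
    at-a = cong (mirror ∘ σ) (Fin.opposite-involutive a)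
    length′ : length (mirrorConfig σ (Fin.opposite a)) ≡ n
    length′ = trans (cong length at-a) (trans (List.length-map Fin.opposite (σ a)) length≡n)
    index′ : index (mirrorConfig σ (Fin.opposite a)) ≡ suc (k ^ n) ∸ i
    index′ = begin
      index (mirrorConfig σ (Fin.opposite a))              ≡⟨ cong index at-a ⟩
      index (mirror (σ a))                                 ≡⟨ m+n∸m≡n (index (σ a)) _ ⟨
      index (σ a) + index (mirror (σ a)) ∸ index (σ a)     ≡⟨ cong₂ _∸_ (index-mirror (σ a)) index≡i ⟩
      suc (k ^ length (σ a)) ∸ i                           ≡⟨ cong (λ ℓ → suc (k ^ ℓ) ∸ i) length≡n ⟩
      suc (k ^ n) ∸ i                                      ∎
      where open ≡-Reasoning

  leftmost-mirror : ∀ {a R} → IsRightmost k n (Fin.opposite a) R → IsLeftmost k n a (suc (k ^ n) ∸ R)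
  leftmost-mirror {a} {R} (reached , bounded) =
    subst (λ b → CanLand k n b (suc (k ^ n) ∸ R)) (Fin.opposite-involutive a) (canLand-mirror reached) ,
    λ i can → m≤n+o⇒m∸n≤o (suc (k ^ n)) R (begin
      suc (k ^ n)              ≤⟨ m≤n+m∸n (suc (k ^ n)) i ⟩
      i + (suc (k ^ n) ∸ i)    ≤⟨ +-monoʳ-≤ i (bounded _ (canLand-mirror can)) ⟩
      i + R                    ≡⟨ +-comm i R ⟩
      R + i                    ∎)
    where open ≤-Reasoning

corollary8p12 :
    ∀ (k n : ℕ) → 2 ≤ k → 1 ≤ n → (a : Fin (k ^ n)) →
    2 ≤ suc (toℕ a) → suc (toℕ a) < k ^ n →
    ∀ (m y j q : ℕ) →
    IsFloorLog k (suc (toℕ a)) m →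
    IsFloorDiv (suc (toℕ a)) (k ^ m) y →
    IsFloorLog k (k ^ n + 1 ∸ suc (toℕ a)) j →
    IsFloorDiv (k ^ n + 1 ∸ suc (toℕ a)) (k ^ j) q →
    IsLeftmost k n a ((k + 1 ∸ q) * k ^ (n ∸ 1 ∸ j))
    × IsRightmost k n a (1 + (y ∸ 1) * k ^ (n ∸ m ∸ 1) + (k ^ n ∸ k ^ (n ∸ m)))
    × HasSpread k n a
        (2 + (y ∸ 1) * k ^ (n ∸ m ∸ 1) + (k ^ n ∸ k ^ (n ∸ m))
           ∸ (k + 1 ∸ q) * k ^ (n ∸ 1 ∸ j))
corollary8p12 k n 2≤k@(s≤s (s≤s z≤n)) _ a 2≤c c<kⁿ m y j q log div log′ div′ =
  leftmost , rightmost′ , (L , R , leftmost , rightmost′ , cong (_∸ L) (+-comm 1 R))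
  where
  L = (k + 1 ∸ q) * k ^ (n ∸ 1 ∸ j)
  R = 1 + (y ∸ 1) * k ^ (n ∸ m ∸ 1) + (k ^ n ∸ k ^ (n ∸ m))
  rightmost′ : IsRightmost k n a R
  rightmost′ = subst (IsRightmost k n a) (rightmostIndex-closed k n m y (floorLog-< log c<kⁿ)) (rightmost 2≤k a log div)
  d≡label : k ^ n + 1 ∸ suc (toℕ a) ≡ suc (toℕ (Fin.opposite a))
  d≡label = sym (label-opposite a)
  d<kⁿ : k ^ n + 1 ∸ suc (toℕ a) < k ^ n
  d<kⁿ = begin-strict
    k ^ n + 1 ∸ suc (toℕ a)   ≤⟨ ∸-monoʳ-≤ (k ^ n + 1) 2≤c ⟩
    k ^ n + 1 ∸ 2             ≡⟨ cong (_∸ 2) (+-comm (k ^ n) 1) ⟩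
    pred (k ^ n)              <⟨ pred[n]<n (k ^ n) {{m^n≢0 k n}} ⟩
    k ^ n                     ∎
    where open ≤-Reasoning
  leftmost : IsLeftmost k n a L
  leftmost = subst (IsLeftmost k n a)
    (mirror-rightmostIndex k n j q (floorLog-< log′ d<kⁿ) (floorDiv-pos (proj₁ log′) div′))
    (Mirror.leftmost-mirror (rightmost 2≤k (Fin.opposite a)
      (subst (λ d → IsFloorLog k d j) d≡label log′) (subst (λ d → IsFloorDiv d (k ^ j) q) d≡label div′)))
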